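{- For all positive integers $t,s,c,\sigma,\gamma$, the optimal number of dinners $r(t,s,c,\sigma,\gamma)$ of the Business Dinner Problem satisfies $$r\geq\left\lceil\frac{s}{t}\max\left(\frac{1}{\sigma}\left\lceil\frac{c}{\gamma}\right\rceil,\max_{j\in\{2,\ldots,\sigma\}}\left(\frac 2 j \left\lceil\frac{c}{\gamma}\right\rceil-\frac{s-1}{j(j-1)}\right)\right)\right\rceil,$$ where the inner maximum over the empty set (when $\sigma=1$) is omitted.
   Context: Business Dinner Problem: given positive integers $t$ (number of tables), $s$ (suppliers), $c$ (customers), $\sigma$ and $\gamma$. A schedule is a finite sequence of dinners; in each dinner, each participant (supplier or customer) sits at at most one of the $t$ tables (participants may be absent from a dinner), and each table hosts at most $\sigma$ suppliers and at most $\gamma$ customers. The schedule is feasible if (i) any two distinct suppliers sit at the same table in at most one dinner, and (ii) every customer and every supplier sit at the same table in exactly one dinner. $r(t,s,c,\sigma,\gamma)$ is the minimum number of dinners of a feasible schedule. -}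

module Defs where

open import Data.Nat using (ℕ; zero; suc; _+_; _*_; _∸_; NonZero)
open import Data.Fin using (Fin)
open import Data.Fin.Properties using (_≟_)
open import Data.Maybe using (Maybe; just; nothing)
open import Data.Maybe.Properties using (≡-dec)
open import Data.List using (List; length; filter; map; foldr; upTo; allFin)
open import Data.Product using (Σ; _×_; ∃)
open import Data.Integer using (ℤ; +_)
open import Data.Rational using (ℚ; _/_; _-_; _⊔_; ceiling)
  renaming (_*_ to _*ℚ_)
open import Relation.Binary.PropositionalEquality using (_≡_; _≢_)
open import Data.Nat using (_≤_)

-- A single dinner: each supplier / customer is either absent (nothing)
-- or sits at exactly one table (just k).
record Dinner (t s c : ℕ) : Set where
  field
    supSeat : Fin s → Maybe (Fin t)
    cusSeat : Fin c → Maybe (Fin t)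
open Dinner public

countAt : {m t : ℕ} → (Fin m → Maybe (Fin t)) → Fin t → ℕ
countAt {m} f k = length (filter (λ i → ≡-dec _≟_ (f i) (just k)) (allFin m))

Capacity : {t s c : ℕ} → (σ γ : ℕ) → Dinner t s c → Set
Capacity {t} σ γ d = (k : Fin t) → countAt (supSeat d) k ≤ σ × countAt (cusSeat d) k ≤ γ

record Schedule (t s c σ γ : ℕ) : Set where
  field
    n        : ℕ
    dinner   : Fin n → Dinner t s c
    capacity : (d : Fin n) → Capacity σ γ (dinner d)
open Schedule public

SupMeet : {t s c σ γ : ℕ} (S : Schedule t s c σ γ) → Fin (n S) → Fin s → Fin s → Set
SupMeet {t} S d a b =
  Σ (Fin t) λ k → supSeat (dinner S d) a ≡ just k × supSeat (dinner S d) b ≡ just k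

SupCusMeet : {t s c σ γ : ℕ} (S : Schedule t s c σ γ) → Fin (n S) → Fin s → Fin c → Set
SupCusMeet {t} S d a e =
  Σ (Fin t) λ k → supSeat (dinner S d) a ≡ just k × cusSeat (dinner S d) e ≡ just k

record Feasible {t s c σ γ : ℕ} (S : Schedule t s c σ γ) : Set where
  field
    atMostOnce : (a b : Fin s) → a ≢ b → (d d′ : Fin (n S)) →
                 SupMeet S d a b → SupMeet S d′ a b → d ≡ d′
    exists     : (a : Fin s) (e : Fin c) → ∃ λ d → SupCusMeet S d a e
    unique     : (a : Fin s) (e : Fin c) (d d′ : Fin (n S)) →
                 SupCusMeet S d a e → SupCusMeet S d′ a e → d ≡ d′

ceilCγ : (c γ : ℕ) → .{{NonZero γ}} → ℚ
ceilCγ c γ = ceiling ((+ c) / γ) / 1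

-- term for j = k + 2 :  (2/j)⌈c/γ⌉ − (s−1)/(j(j−1))
termJ : (s c γ : ℕ) → .{{NonZero γ}} → ℕ → ℚ
termJ s c γ k = (((+ 2) / (2 + k)) *ℚ ceilCγ c γ) - ((+ (s ∸ 1)) / ((2 + k) * (1 + k)))

-- max( (1/σ)⌈c/γ⌉ , max_{j ∈ {2..σ}} termJ ), inner max omitted when σ = 1
innerMax : (s c σ γ : ℕ) → .{{NonZero σ}} → .{{NonZero γ}} → ℚ
innerMax s c σ γ =
  foldr _⊔_ (((+ 1) / σ) *ℚ ceilCγ c γ) (map (termJ s c γ) (upTo (σ ∸ 1)))

lowerBound : (t s c σ γ : ℕ) → .{{NonZero t}} → .{{NonZero σ}} → .{{NonZero γ}} → ℤ
lowerBound t s c σ γ = ceiling (((+ s) / t) *ℚ innerMax s c σ γ)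

-- Let X(d,k) be the number of suppliers at table k of dinner d, and T = Σ X(d,k) the number of
-- supplier seatings. A supplier meets every customer exactly once and at most γ customers per
-- dinner, so it attends at least ⌈c/γ⌉ dinners; hence s⌈c/γ⌉ ≤ T ≤ r t σ, the first bound.
-- Counting ordered pairs of suppliers at a common table, and using that distinct suppliers share a
-- table at most once, gives Σ X(d,k)² ≤ T + s(s − 1). As (x − j)(x − j + 1) ≥ 0 for integers,
-- (2j − 1) x ≤ x² + j(j − 1); summing over the r t tables yields
-- 2(j − 1) T ≤ s(s − 1) + r t j(j − 1), which together with T ≥ s⌈c/γ⌉ is the bound for j.
-- The rational inequalities are finally checked by clearing denominators.

module Submission where

open import Defs

open import Data.Nat using (ℕ; zero; suc; NonZero; _+_; _*_; _≤_; _≤?_; z≤n; s≤s)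
open import Data.Nat.Properties hiding (_≟_; suc-injective)
open import Data.Nat.Coprimality using (Coprime)
open import Data.Nat.Solver using (module +-*-Solver)
open import Algebra.Properties.Semiring.Sum +-*-semiring
  using (sum; sum-syntax; sum-cong-≗; sum-remove; ∑-comm; ∑-distrib-+; *-distribˡ-sum; *-distribʳ-sum)
open import Data.Integer as ℤ using (ℤ; +_; +0; -[1+_]; +[1+_]; +≤+)
import Data.Integer.Properties as ℤ
open import Data.Integer.Solver using () renaming (module +-*-Solver to ℤSolver)
open import Data.Integer.DivMod using (n<s[n/ℕd]*d)
open import Data.Rational as ℚ using (ℚ; mkℚ; _/_; _⊔_; ceiling; toℚᵘ)
import Data.Rational.Properties as ℚ
open import Data.Rational.Unnormalised as ℚᵘ using (ℚᵘ; mkℚᵘ; *≤*; ↥_; ↧_)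
import Data.Rational.Unnormalised.Properties as ℚᵘ
open import Data.Fin using (Fin; zero; suc; punchIn)
open import Data.Fin.Properties using (_≟_; suc-injective; punchInᵢ≢i)
open import Data.Maybe using (Maybe; just)
open import Data.Maybe.Properties using (≡-dec; just-injective)
open import Data.List using ([]; _∷_; length; filter; tabulate; map; foldr; upTo)
open import Data.Sum using ([_,_]′)
open import Data.Product using (Σ; ∃-syntax; _×_; _,_; proj₁; proj₂)
open import Function using (_∘_; id)
open import Relation.Nullary using (Dec; yes; no; contradiction)
open import Relation.Unary using (Decidable)
open import Relation.Binary.PropositionalEquality
  using (_≡_; _≢_; refl; sym; trans; cong; cong₂; subst; module ≡-Reasoning)

∑-mono-≤ : ∀ {m} {f g : Fin m → ℕ} → (∀ i → f i ≤ g i) → sum f ≤ sum g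
∑-mono-≤ {zero}  f≤g = z≤n
∑-mono-≤ {suc m} f≤g = +-mono-≤ (f≤g zero) (∑-mono-≤ (f≤g ∘ suc))

∑-const : ∀ m k → ∑[ i < m ] k ≡ m * k
∑-const zero    k = refl
∑-const (suc m) k = cong (λ r → k + r) (∑-const m k)

≤-∑ : ∀ {m} (f : Fin m → ℕ) i → f i ≤ sum f
≤-∑ {suc m} f i = subst (f i ≤_) (sym (sum-remove f)) (m≤m+n (f i) _)

1≤∑⇒∃1≤ : ∀ {m} (f : Fin m → ℕ) → 1 ≤ sum f → ∃[ i ] 1 ≤ f i
1≤∑⇒∃1≤ {suc m} f 1≤∑ with f zero in eq
... | suc _ = zero , subst (1 ≤_) (sym eq) (s≤s z≤n)
... | zero  = let i , 1≤fi = 1≤∑⇒∃1≤ (f ∘ suc) 1≤∑ in suc i , 1≤fi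

∑≡0 : ∀ {m} (f : Fin m → ℕ) → (∀ i → f i ≡ 0) → sum f ≡ 0
∑≡0 {zero}  f f≡0 = refl
∑≡0 {suc m} f f≡0 = cong₂ _+_ (f≡0 zero) (∑≡0 (f ∘ suc) (f≡0 ∘ suc))

∑≤1 : ∀ {m} (f : Fin m → ℕ) → (∀ i → f i ≤ 1) →
      (∀ i j → 1 ≤ f i → 1 ≤ f j → i ≡ j) → sum f ≤ 1
∑≤1 {zero}  f f≤1 unique = z≤n
∑≤1 {suc m} f f≤1 unique with f zero in eq
... | zero  = ∑≤1 (f ∘ suc) (f≤1 ∘ suc) (λ i j p q → suc-injective (unique (suc i) (suc j) p q))
... | suc w = subst (λ r → suc w + r ≤ 1) (sym (∑≡0 (f ∘ suc) others))
                (subst (_≤ 1) (trans eq (sym (+-identityʳ (suc w)))) (f≤1 zero))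
  where
  others : ∀ i → f (suc i) ≡ 0
  others i with f (suc i) in eq′
  ... | zero  = refl
  ... | suc _ = contradiction (unique zero (suc i) (1≤ eq) (1≤ eq′)) λ ()
    where
    1≤ : ∀ {x y} → x ≡ suc y → 1 ≤ x
    1≤ refl = s≤s z≤n

∑+1≤ : ∀ {m} (f : Fin m → ℕ) i → (∀ j → j ≢ i → f j ≤ 1) → sum f + 1 ≤ f i + m
∑+1≤ {suc m} f i others≤1 = begin
  sum f + 1                      ≡⟨ cong (_+ 1) (sum-remove f) ⟩
  f i + sum (f ∘ punchIn i) + 1
    ≤⟨ +-monoˡ-≤ 1 (+-monoʳ-≤ (f i) (∑-mono-≤ λ j → others≤1 (punchIn i j) (punchInᵢ≢i i j))) ⟩
  f i + ∑[ j < m ] 1 + 1         ≡⟨ cong (λ r → f i + r + 1) (trans (∑-const m 1) (*-identityʳ m)) ⟩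
  f i + m + 1                    ≡⟨ +-assoc (f i) m 1 ⟩
  f i + (m + 1)                  ≡⟨ cong (λ r → f i + r) (+-comm m 1) ⟩
  f i + suc m                    ∎
  where open ≤-Reasoning

[_] : ∀ {p} {P : Set p} → Dec P → ℕ
[ yes _ ] = 1
[ no  _ ] = 0

length-filter-tabulate : ∀ {a p m} {A : Set a} {P : A → Set p} (P? : Decidable P) (f : Fin m → A) →
                         length (filter P? (tabulate f)) ≡ ∑[ i < m ] [ P? (f i) ]
length-filter-tabulate {m = zero}  P? f = refl
length-filter-tabulate {m = suc m} P? f with P? (f zero)
... | yes _ = cong suc (length-filter-tabulate P? (f ∘ suc))
... | no  _ = length-filter-tabulate P? (f ∘ suc)

seated : ∀ {t} → Maybe (Fin t) → Fin t → ℕ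
seated x k = [ ≡-dec _≟_ x (just k) ]

countAt≡∑seated : ∀ {m t} (f : Fin m → Maybe (Fin t)) k → countAt f k ≡ ∑[ i < m ] seated (f i) k
countAt≡∑seated f k = length-filter-tabulate (λ i → ≡-dec _≟_ (f i) (just k)) id

seated-≡1 : ∀ {t} {x : Maybe (Fin t)} {k} → x ≡ just k → seated x k ≡ 1
seated-≡1 {x = x} {k} x≡k with ≡-dec _≟_ x (just k)
... | yes _   = refl
... | no  x≢k = contradiction x≡k x≢k

seated≤1 : ∀ {t} (x : Maybe (Fin t)) k → seated x k ≤ 1
seated≤1 x k with ≡-dec _≟_ x (just k)
... | yes _ = s≤s z≤n
... | no  _ = z≤n

seated-pos : ∀ {t} (x : Maybe (Fin t)) k → 1 ≤ seated x k → x ≡ just k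
seated-pos x k 1≤ with ≡-dec _≟_ x (just k)
... | yes x≡k = x≡k
seated-pos x k () | no _

seated-idem : ∀ {t} (x : Maybe (Fin t)) k → seated x k * seated x k ≡ seated x k
seated-idem x k with ≡-dec _≟_ x (just k)
... | yes _ = refl
... | no  _ = refl

present : ∀ {t} → Maybe (Fin t) → ℕ
present {t} x = ∑[ k < t ] seated x k

present≤1 : ∀ {t} (x : Maybe (Fin t)) → present x ≤ 1
present≤1 x = ∑≤1 (seated x) (seated≤1 x)
  λ k k′ 1≤k 1≤k′ → just-injective (trans (sym (seated-pos x k 1≤k)) (seated-pos x k′ 1≤k′))

together : ∀ {t} → Maybe (Fin t) → Maybe (Fin t) → ℕ
together {t} x y = ∑[ k < t ] (seated x k * seated y k)

seated*seated≤ˡ : ∀ {t} (x y : Maybe (Fin t)) k → seated x k * seated y k ≤ seated x k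
seated*seated≤ˡ x y k = ≤-trans (*-monoʳ-≤ (seated x k) (seated≤1 y k)) (≤-reflexive (*-identityʳ _))

seated*seated≤ʳ : ∀ {t} (x y : Maybe (Fin t)) k → seated x k * seated y k ≤ seated y k
seated*seated≤ʳ x y k = subst (_≤ seated y k) (*-comm (seated y k) (seated x k)) (seated*seated≤ˡ y x k)

module _ {t : ℕ} {x y : Maybe (Fin t)} where

  together-pos : ∀ {k} → x ≡ just k → y ≡ just k → 1 ≤ together x y
  together-pos {k} x≡k y≡k = subst (_≤ together x y) (cong₂ _*_ (seated-≡1 x≡k) (seated-≡1 y≡k))
    (≤-∑ (λ k → seated x k * seated y k) k)

  together⇒sameTable : 1 ≤ together x y → Σ (Fin t) λ k → x ≡ just k × y ≡ just k
  together⇒sameTable 1≤ with 1≤∑⇒∃1≤ (λ k → seated x k * seated y k) 1≤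
  ... | k , 1≤xy = k , seated-pos x k (≤-trans 1≤xy (seated*seated≤ˡ x y k))
                     , seated-pos y k (≤-trans 1≤xy (seated*seated≤ʳ x y k))

together≤present : ∀ {t} (x y : Maybe (Fin t)) → together x y ≤ present x
together≤present x y = ∑-mono-≤ (seated*seated≤ˡ x y)

together-self : ∀ {t} (x : Maybe (Fin t)) → together x x ≡ present x
together-self x = sum-cong-≗ (seated-idem x)

[2k+1]x≤x²+[1+k]k : ∀ k x → (2 * k + 1) * x ≤ x * x + (1 + k) * k
[2k+1]x≤x²+[1+k]k k x with x ≤? k
... | yes x≤k =
  let o , x+o≡k = m≤n⇒∃[o]m+o≡n x≤k in
  subst (λ k → (2 * k + 1) * x ≤ x * x + (1 + k) * k) x+o≡k
    (≤-trans (m≤m+n _ (o * o + o)) (≤-reflexive (slack x o)))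
  where
  slack : ∀ x o → (2 * (x + o) + 1) * x + (o * o + o) ≡ x * x + (1 + (x + o)) * (x + o)
  slack = solve 2 (λ x o → (con 2 :* (x :+ o) :+ con 1) :* x :+ (o :* o :+ o)
                           := x :* x :+ (con 1 :+ (x :+ o)) :* (x :+ o)) refl
    where open +-*-Solver
... | no x≰k =
  let o , k+1+o≡x = m≤n⇒∃[o]m+o≡n (≰⇒> x≰k) in
  subst (λ x → (2 * k + 1) * x ≤ x * x + (1 + k) * k) k+1+o≡x
    (≤-trans (m≤m+n _ (o * o + o)) (≤-reflexive (slack k o)))
  where
  slack : ∀ k o → (2 * k + 1) * (suc k + o) + (o * o + o) ≡ (suc k + o) * (suc k + o) + (1 + k) * k
  slack = solve 2 (λ k o → (con 2 :* k :+ con 1) :* (con 1 :+ k :+ o) :+ (o :* o :+ o)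
                           := (con 1 :+ k :+ o) :* (con 1 :+ k :+ o) :+ (con 1 :+ k) :* k) refl
    where open +-*-Solver

module Counting {t s c σ γ : ℕ} (S : Schedule t s c σ γ) where

  seat : Fin (n S) → Fin s → Maybe (Fin t)
  seat d = supSeat (dinner S d)

  sits : Fin (n S) → Fin s → Fin t → ℕ
  sits d a = seated (seat d a)

  customerSits : Fin (n S) → Fin c → Fin t → ℕ
  customerSits d e = seated (cusSeat (dinner S d) e)

  occupancy : Fin (n S) → Fin t → ℕ
  occupancy d k = ∑[ a < s ] sits d a k

  attendance : Fin s → ℕ
  attendance a = ∑[ d < n S ] present (seat d a)

  encounters : Fin s → Fin s → ℕ
  encounters a b = ∑[ d < n S ] together (seat d a) (seat d b)

  seatings : ℕ
  seatings = ∑[ d < n S ] ∑[ k < t ] occupancy d k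

  coseatings : ℕ
  coseatings = ∑[ d < n S ] ∑[ k < t ] (occupancy d k * occupancy d k)

  ∑attendance≡seatings : ∑[ a < s ] attendance a ≡ seatings
  ∑attendance≡seatings = trans (∑-comm (λ a d → present (seat d a)))
                               (sum-cong-≗ λ d → ∑-comm (λ a k → sits d a k))

  seatings≤capacity : seatings ≤ n S * (t * σ)
  seatings≤capacity = begin
    seatings                   ≤⟨ ∑-mono-≤ (λ d → ∑-mono-≤ (occupancy≤σ d)) ⟩
    ∑[ d < n S ] ∑[ k < t ] σ  ≡⟨ trans (sum-cong-≗ {n S} λ _ → ∑-const t σ) (∑-const (n S) (t * σ)) ⟩
    n S * (t * σ)              ∎
    where
    open ≤-Reasoning
    occupancy≤σ : ∀ d k → occupancy d k ≤ σ
    occupancy≤σ d k = subst (_≤ σ) (countAt≡∑seated (seat d) k) (proj₁ (capacity S d k))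

  c≤γ*attendance : ∀ a → (∀ e → ∃[ d ] SupCusMeet S d a e) → c ≤ γ * attendance a
  c≤γ*attendance a meets = begin
    c                                                     ≡⟨ trans (∑-const c 1) (*-identityʳ c) ⟨
    ∑[ e < c ] 1                                          ≤⟨ ∑-mono-≤ met ⟩
    ∑[ e < c ] ∑[ d < n S ] ∑[ k < t ] (sits d a k * customerSits d e k)
      ≡⟨ ∑-comm (λ e d → ∑[ k < t ] (sits d a k * customerSits d e k)) ⟩
    ∑[ d < n S ] ∑[ e < c ] ∑[ k < t ] (sits d a k * customerSits d e k)
      ≡⟨ sum-cong-≗ {n S} (λ d → ∑-comm λ e k → sits d a k * customerSits d e k) ⟩
    ∑[ d < n S ] ∑[ k < t ] ∑[ e < c ] (sits d a k * customerSits d e k)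
      ≡⟨ sum-cong-≗ {n S} (λ d → sum-cong-≗ {t} λ k → *-distribˡ-sum (sits d a k) (λ e → customerSits d e k)) ⟨
    ∑[ d < n S ] ∑[ k < t ] (sits d a k * ∑[ e < c ] customerSits d e k)
      ≤⟨ ∑-mono-≤ (λ d → ∑-mono-≤ λ k → *-monoʳ-≤ (sits d a k) (customers≤γ d k)) ⟩
    ∑[ d < n S ] ∑[ k < t ] (sits d a k * γ)
      ≡⟨ sum-cong-≗ {n S} (λ d → *-distribʳ-sum γ (sits d a)) ⟨
    ∑[ d < n S ] (present (seat d a) * γ)                 ≡⟨ *-distribʳ-sum γ (λ d → present (seat d a)) ⟨
    attendance a * γ                                      ≡⟨ *-comm (attendance a) γ ⟩
    γ * attendance a                                      ∎
    where
    open ≤-Reasoning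
    met : ∀ e → 1 ≤ ∑[ d < n S ] ∑[ k < t ] (sits d a k * customerSits d e k)
    met e = let d , k , a∈k , e∈k = meets e in
      ≤-trans (together-pos a∈k e∈k) (≤-∑ (λ d → ∑[ k < t ] (sits d a k * customerSits d e k)) d)
    customers≤γ : ∀ d k → ∑[ e < c ] customerSits d e k ≤ γ
    customers≤γ d k = subst (_≤ γ) (countAt≡∑seated (cusSeat (dinner S d)) k) (proj₂ (capacity S d k))

  coseatings≡∑encounters : coseatings ≡ ∑[ a < s ] ∑[ b < s ] encounters a b
  coseatings≡∑encounters = begin
    coseatings
      ≡⟨ sum-cong-≗ {n S} (λ d → sum-cong-≗ {t} λ k → occupancy²≡ d k) ⟩
    ∑[ d < n S ] ∑[ k < t ] ∑[ a < s ] ∑[ b < s ] (sits d a k * sits d b k)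
      ≡⟨ sum-cong-≗ {n S} (λ d → ∑-comm λ k a → ∑[ b < s ] (sits d a k * sits d b k)) ⟩
    ∑[ d < n S ] ∑[ a < s ] ∑[ k < t ] ∑[ b < s ] (sits d a k * sits d b k)
      ≡⟨ ∑-comm (λ d a → ∑[ k < t ] ∑[ b < s ] (sits d a k * sits d b k)) ⟩
    ∑[ a < s ] ∑[ d < n S ] ∑[ k < t ] ∑[ b < s ] (sits d a k * sits d b k)
      ≡⟨ sum-cong-≗ {s} (λ a → sum-cong-≗ {n S} λ d → ∑-comm λ k b → sits d a k * sits d b k) ⟩
    ∑[ a < s ] ∑[ d < n S ] ∑[ b < s ] together (seat d a) (seat d b)
      ≡⟨ sum-cong-≗ {s} (λ a → ∑-comm λ d b → together (seat d a) (seat d b)) ⟩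
    ∑[ a < s ] ∑[ b < s ] encounters a b
      ∎
    where
    open ≡-Reasoning
    occupancy²≡ : ∀ d k → occupancy d k * occupancy d k ≡ ∑[ a < s ] ∑[ b < s ] (sits d a k * sits d b k)
    occupancy²≡ d k = trans (*-distribʳ-sum (occupancy d k) (λ a → sits d a k))
                            (sum-cong-≗ {s} λ a → *-distribˡ-sum (sits d a k) (λ b → sits d b k))

  encounters≤1 : Feasible S → ∀ a b → a ≢ b → encounters a b ≤ 1
  encounters≤1 F a b a≢b = ∑≤1 (λ d → together (seat d a) (seat d b))
    (λ d → ≤-trans (together≤present (seat d a) (seat d b)) (present≤1 (seat d a)))
    (λ d d′ 1≤d 1≤d′ → Feasible.atMostOnce F a b a≢b d d′ (together⇒sameTable 1≤d) (together⇒sameTable 1≤d′))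

  coseatings+s≤seatings+s² : Feasible S → coseatings + s ≤ seatings + s * s
  coseatings+s≤seatings+s² F = begin
    coseatings + s
      ≡⟨ cong₂ _+_ coseatings≡∑encounters (sym (trans (∑-const s 1) (*-identityʳ s))) ⟩
    ∑[ a < s ] ∑[ b < s ] encounters a b + ∑[ a < s ] 1
      ≡⟨ ∑-distrib-+ (λ a → ∑[ b < s ] encounters a b) (λ _ → 1) ⟨
    ∑[ a < s ] (∑[ b < s ] encounters a b + 1)
      ≤⟨ ∑-mono-≤ (λ a → ∑+1≤ (encounters a) a λ b b≢a → encounters≤1 F a b (b≢a ∘ sym)) ⟩
    ∑[ a < s ] (encounters a a + s)
      ≡⟨ ∑-distrib-+ (λ a → encounters a a) (λ _ → s) ⟩
    ∑[ a < s ] encounters a a + ∑[ a < s ] s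
      ≡⟨ cong₂ _+_ (trans (sum-cong-≗ {s} λ a → sum-cong-≗ {n S} λ d → together-self (seat d a))
                          ∑attendance≡seatings)
                   (∑-const s s) ⟩
    seatings + s * s
      ∎
    where open ≤-Reasoning

  [2m+1]seatings≤ : ∀ m → (2 * m + 1) * seatings ≤ coseatings + n S * (t * ((1 + m) * m))
  [2m+1]seatings≤ m = begin
    (2 * m + 1) * seatings
      ≡⟨ trans (*-distribˡ-sum (2 * m + 1) (λ d → ∑[ k < t ] occupancy d k))
               (sum-cong-≗ {n S} λ d → *-distribˡ-sum (2 * m + 1) (occupancy d)) ⟩
    ∑[ d < n S ] ∑[ k < t ] ((2 * m + 1) * occupancy d k)
      ≤⟨ ∑-mono-≤ (λ d → ∑-mono-≤ λ k → [2k+1]x≤x²+[1+k]k m (occupancy d k)) ⟩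
    ∑[ d < n S ] ∑[ k < t ] (occupancy d k * occupancy d k + (1 + m) * m)
      ≡⟨ sum-cong-≗ {n S} (λ d → trans (∑-distrib-+ (λ k → occupancy d k * occupancy d k) (λ _ → (1 + m) * m))
                                       (cong (λ r → ∑[ k < t ] (occupancy d k * occupancy d k) + r) (∑-const t _))) ⟩
    ∑[ d < n S ] (∑[ k < t ] (occupancy d k * occupancy d k) + t * ((1 + m) * m))
      ≡⟨ trans (∑-distrib-+ (λ d → ∑[ k < t ] (occupancy d k * occupancy d k)) (λ _ → t * ((1 + m) * m)))
               (cong (λ r → coseatings + r) (∑-const (n S) _)) ⟩
    coseatings + n S * (t * ((1 + m) * m))
      ∎
    where open ≤-Reasoning

  seatings-pair-bound : Feasible S → ∀ m → 2 * m * seatings + s ≤ s * s + n S * (t * ((1 + m) * m))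
  seatings-pair-bound F m = +-cancelˡ-≤ seatings _ _ (begin
    seatings + (2 * m * seatings + s)   ≡⟨ rearrangeˡ m seatings s ⟩
    (2 * m + 1) * seatings + s          ≤⟨ +-monoˡ-≤ s ([2m+1]seatings≤ m) ⟩
    coseatings + rest + s               ≡⟨ rearrangeʳ coseatings rest s ⟩
    coseatings + s + rest               ≤⟨ +-monoˡ-≤ rest (coseatings+s≤seatings+s² F) ⟩
    seatings + s * s + rest             ≡⟨ +-assoc seatings (s * s) rest ⟩
    seatings + (s * s + rest)           ∎)
    where
    open ≤-Reasoning
    open +-*-Solver
    rest : ℕ
    rest = n S * (t * ((1 + m) * m))
    rearrangeˡ : ∀ m T s → T + (2 * m * T + s) ≡ (2 * m + 1) * T + s
    rearrangeˡ = solve 3 (λ m T s → T :+ (con 2 :* m :* T :+ s) := (con 2 :* m :+ con 1) :* T :+ s) refl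
    rearrangeʳ : ∀ Q R s → Q + R + s ≡ Q + s + R
    rearrangeʳ = solve 3 (λ Q R s → Q :+ R :+ s := Q :+ s :+ R) refl

toℚᵘ-/ : ∀ i d .{{_ : NonZero d}} → toℚᵘ (i / d) ℚᵘ.≃ i ℚᵘ./ d
toℚᵘ-/ i (suc d) = ℚ.toℚᵘ-fromℚᵘ (mkℚᵘ i d)

-- The left-hand side is ⌈x / D⌉.
-⌊-x/D⌋≤ : ∀ x D .{{_ : NonZero D}} i → x ℤ.≤ i ℤ.* + D → ℤ.- ((ℤ.- x) ℤ./ℕ D) ℤ.≤ i
-⌊-x/D⌋≤ x D i x≤iD = subst (ℤ.- F ℤ.≤_) (ℤ.neg-involutive i) (ℤ.neg-mono-≤ -i≤F)
  where
  F : ℤ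
  F = (ℤ.- x) ℤ./ℕ D
  -iD≤-x : ℤ.- i ℤ.* + D ℤ.≤ ℤ.- x
  -iD≤-x = subst (ℤ._≤ ℤ.- x) (ℤ.neg-distribˡ-* i (+ D)) (ℤ.neg-mono-≤ x≤iD)
  -i<1+F : ℤ.- i ℤ.< ℤ.suc F
  -i<1+F = ℤ.*-cancelʳ-<-nonNeg (+ D) (ℤ.≤-<-trans -iD≤-x (n<s[n/ℕd]*d (ℤ.- x) D))
  -i≤F : ℤ.- i ℤ.≤ F
  -i≤F = subst (ℤ.- i ℤ.≤_) (ℤ.pred-suc F) (ℤ.i<j⇒i≤pred[j] -i<1+F)

ceiling-mkℚ : ∀ num d .(c : Coprime ℤ.∣ num ∣ (suc d)) → ceiling (mkℚ num d c) ≡ ℤ.- ((ℤ.- num) ℤ./ℕ suc d)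
ceiling-mkℚ -[1+ n ] d c = cong ℤ.-_ (ℤ.*-identityˡ (+[1+ n ] ℤ./ℕ suc d))
ceiling-mkℚ +0       d c = cong ℤ.-_ (ℤ.*-identityˡ (+0 ℤ./ℕ suc d))
ceiling-mkℚ +[1+ n ] d c = cong ℤ.-_ (ℤ.*-identityˡ (-[1+ n ] ℤ./ℕ suc d))

ceiling-≤ : ∀ p i → p ℚ.≤ i / 1 → ceiling p ℤ.≤ i
ceiling-≤ (mkℚ num d c) i p≤i with ℚᵘ.≤-respʳ-≃ (toℚᵘ-/ i 1) (ℚ.toℚᵘ-mono-≤ p≤i)
... | *≤* num≤id = subst (ℤ._≤ i) (sym (ceiling-mkℚ num d c))
  (-⌊-x/D⌋≤ num (suc d) i (subst (ℤ._≤ i ℤ.* + suc d) (ℤ.*-identityʳ num) num≤id))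

≤-/1-cross : ∀ {q} (p : ℚᵘ) m → toℚᵘ q ℚᵘ.≃ p → ↥ p ℤ.≤ m ℤ.* ↧ p → q ℚ.≤ m / 1
≤-/1-cross p m q≃p ↥p≤m↧p = ℚ.toℚᵘ-cancel-≤
  (ℚᵘ.≤-respˡ-≃ (ℚᵘ.≃-sym q≃p) (ℚᵘ.≤-respʳ-≃ (ℚᵘ.≃-sym (toℚᵘ-/ m 1))
    (*≤* (subst (ℤ._≤ m ℤ.* ↧ p) (sym (ℤ.*-identityʳ (↥ p))) ↥p≤m↧p))))

ceiling-/-≤ : ∀ c γ m .{{_ : NonZero γ}} → c ≤ γ * m → ceiling (+ c / γ) ℤ.≤ + m
ceiling-/-≤ c γ@(suc _) m c≤γm = ceiling-≤ (+ c / γ) (+ m) (≤-/1-cross (+ c ℚᵘ./ γ) (+ m) (toℚᵘ-/ (+ c) γ) c≤mγ)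
  where
  c≤mγ : + c ℤ.≤ + m ℤ.* ↧ (+ c ℚᵘ./ γ)
  c≤mγ = subst (+ c ℤ.≤_) (trans (cong +_ (*-comm γ m)) (ℤ.pos-* m γ)) (+≤+ c≤γm)

⊔-preserves : ∀ {ℓ} (P : ℚ → Set ℓ) {p q} → P p → P q → P (p ⊔ q)
⊔-preserves P {p} {q} Pp Pq =
  [ (λ p⊔q≡p → subst P (sym p⊔q≡p) Pp) , (λ p⊔q≡q → subst P (sym p⊔q≡q) Pq) ]′ (ℚ.⊔-sel p q)

foldr-⊔-preserves : ∀ {a ℓ} {A : Set a} (P : ℚ → Set ℓ) {b} (f : A → ℚ) →
                    P b → (∀ x → P (f x)) → ∀ xs → P (foldr _⊔_ b (map f xs))
foldr-⊔-preserves P f Pb Pf []       = Pb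
foldr-⊔-preserves P f Pb Pf (x ∷ xs) = ⊔-preserves P (Pf x) (foldr-⊔-preserves P f Pb Pf xs)

m*i≤∑ : ∀ {m} (i : ℤ) (f : Fin m → ℕ) → (∀ a → i ℤ.≤ + f a) → + m ℤ.* i ℤ.≤ + sum f
m*i≤∑ {zero}  i f i≤f = ℤ.≤-reflexive (ℤ.*-zeroˡ i)
m*i≤∑ {suc m} i f i≤f = begin
  + suc m ℤ.* i                ≡⟨ ℤ.suc-* (+ m) i ⟩
  i ℤ.+ + m ℤ.* i              ≤⟨ ℤ.+-mono-≤ (i≤f zero) (m*i≤∑ i (f ∘ suc) (i≤f ∘ suc)) ⟩
  + f zero ℤ.+ + sum (f ∘ suc) ≡⟨ ℤ.pos-+ (f zero) (sum (f ∘ suc)) ⟨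
  + sum f                      ∎
  where open ℤ.≤-Reasoning

toℚᵘ-scale : ∀ s t .{{_ : NonZero t}} {q p} →
             toℚᵘ q ℚᵘ.≃ p → toℚᵘ ((+ s / t) ℚ.* q) ℚᵘ.≃ (+ s ℚᵘ./ t) ℚᵘ.* p
toℚᵘ-scale s t {q} q≃p = ℚᵘ.≃-trans (ℚ.toℚᵘ-homo-* (+ s / t) q) (ℚᵘ.*-cong (toℚᵘ-/ (+ s) t) q≃p)

capacity-bound : ∀ {s t′ σ′ n T} (C : ℤ) → + s ℤ.* C ℤ.≤ + T → T ≤ n * (suc t′ * suc σ′) →
                 (+ s / suc t′) ℚ.* ((+ 1 / suc σ′) ℚ.* (C / 1)) ℚ.≤ + n / 1
capacity-bound {s} {t′} {σ′} {n} {T} C sC≤T T≤ntσ =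
  ≤-/1-cross _ (+ n) (toℚᵘ-scale s (suc t′) value) (begin
    + s ℤ.* (+ 1 ℤ.* C)                 ≡⟨ cong (+ s ℤ.*_) (ℤ.*-identityˡ C) ⟩
    + s ℤ.* C                           ≤⟨ sC≤T ⟩
    + T                                 ≤⟨ +≤+ T≤ntσ ⟩
    + (n * (suc t′ * suc σ′))           ≡⟨ cong (λ x → + (n * (suc t′ * x))) (*-identityʳ (suc σ′)) ⟨
    + (n * (suc t′ * (suc σ′ * 1)))     ≡⟨ ℤ.pos-* n _ ⟩
    + n ℤ.* + (suc t′ * (suc σ′ * 1))   ∎)
  where
  open ℤ.≤-Reasoning
  value : toℚᵘ ((+ 1 / suc σ′) ℚ.* (C / 1)) ℚᵘ.≃ (+ 1 ℚᵘ./ suc σ′) ℚᵘ.* (C ℚᵘ./ 1)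
  value = ℚᵘ.≃-trans (ℚ.toℚᵘ-homo-* (+ 1 / suc σ′) (C / 1)) (ℚᵘ.*-cong (toℚᵘ-/ (+ 1) (suc σ′)) (toℚᵘ-/ C 1))

termJᵘ : (s′ k : ℕ) (C : ℤ) → ℚᵘ
termJᵘ s′ k C = (+ 2 ℚᵘ./ (2 + k)) ℚᵘ.* (C ℚᵘ./ 1) ℚᵘ.- (+ s′ ℚᵘ./ ((2 + k) * (1 + k)))

toℚᵘ-termJ : ∀ s′ k C → toℚᵘ ((+ 2 / (2 + k)) ℚ.* (C / 1) ℚ.- + s′ / ((2 + k) * (1 + k))) ℚᵘ.≃ termJᵘ s′ k C
toℚᵘ-termJ s′ k C = ℚᵘ.≃-trans (ℚ.toℚᵘ-homo-+ 2C/j (ℚ.- s′/jK))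
  (ℚᵘ.+-cong (ℚᵘ.≃-trans (ℚ.toℚᵘ-homo-* (+ 2 / (2 + k)) (C / 1)) (ℚᵘ.*-cong (toℚᵘ-/ (+ 2) (2 + k)) (toℚᵘ-/ C 1)))
             (ℚᵘ.≃-trans (ℚ.toℚᵘ-homo‿- s′/jK) (ℚᵘ.-‿cong (toℚᵘ-/ (+ s′) ((2 + k) * (1 + k))))))
  where
  2C/j s′/jK : ℚ
  2C/j  = (+ 2 / (2 + k)) ℚ.* (C / 1)
  s′/jK = + s′ / ((2 + k) * (1 + k))

-- With j = 2 + k and K = 1 + k, this is s(2 C jK − (s − 1) j) ≤ n t j² K.
termJᵘ-cross : ∀ {s′ t′ n T} (C : ℤ) k → + suc s′ ℤ.* C ℤ.≤ + T →
               2 * (1 + k) * T + suc s′ ≤ suc s′ * suc s′ + n * (suc t′ * ((2 + k) * (1 + k))) →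
               let p = (+ suc s′ ℚᵘ./ suc t′) ℚᵘ.* termJᵘ s′ k C in ↥ p ℤ.≤ + n ℤ.* ↧ p
termJᵘ-cross {s′} {t′} {n} {T} C k sC≤T pairs = begin
  + s ℤ.* ((+ 2 ℤ.* C) ℤ.* + (j * K) ℤ.+ ℤ.- (+ s′) ℤ.* + (j * 1))
    ≡⟨ cong₂ (λ a b → + s ℤ.* ((+ 2 ℤ.* C) ℤ.* a ℤ.+ ℤ.- (+ s′) ℤ.* b)) (ℤ.pos-* j K) (cong +_ (*-identityʳ j)) ⟩
  + s ℤ.* ((+ 2 ℤ.* C) ℤ.* (+ j ℤ.* + K) ℤ.+ ℤ.- (+ s′) ℤ.* + j)
    ≡⟨ expand (+ s′) (+ k) C ⟩
  + j ℤ.* (+ 2 ℤ.* + K ℤ.* (+ s ℤ.* C)) ℤ.- + j ℤ.* (+ s ℤ.* + s′)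
    ≤⟨ ℤ.+-monoˡ-≤ _ (ℤ.*-monoˡ-≤-nonNeg (+ j) 2KsC≤ss′+X) ⟩
  + j ℤ.* (+ s ℤ.* + s′ ℤ.+ + X) ℤ.- + j ℤ.* (+ s ℤ.* + s′)
    ≡⟨ cancel (+ j) (+ s ℤ.* + s′) (+ X) ⟩
  + j ℤ.* + X
    ≡⟨ ℤ.pos-* j X ⟨
  + (j * X)
    ≡⟨ cong +_ (reorder n (suc t′) j K) ⟩
  + (n * (suc t′ * (j * 1 * (j * K))))
    ≡⟨ ℤ.pos-* n _ ⟩
  + n ℤ.* + (suc t′ * (j * 1 * (j * K)))
    ∎
  where
  open ℤ.≤-Reasoning
  s j K X : ℕ
  s = suc s′
  j = 2 + k
  K = 1 + k
  X = n * (suc t′ * (j * K))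
  peel : ∀ s′ X → suc s′ * suc s′ + X ≡ suc s′ * s′ + X + suc s′
  peel = solve 2 (λ s′ X → let s = con 1 :+ s′ in s :* s :+ X := s :* s′ :+ X :+ s) refl
    where open +-*-Solver
  2KT≤ss′+X : 2 * K * T ≤ s * s′ + X
  2KT≤ss′+X = +-cancelʳ-≤ s _ _ (≤-trans pairs (≤-reflexive (peel s′ X)))
  2KsC≤ss′+X : + 2 ℤ.* + K ℤ.* (+ s ℤ.* C) ℤ.≤ + s ℤ.* + s′ ℤ.+ + X
  2KsC≤ss′+X = begin
    + 2 ℤ.* + K ℤ.* (+ s ℤ.* C) ≤⟨ ℤ.*-monoˡ-≤-nonNeg (+ 2 ℤ.* + K) sC≤T ⟩
    + 2 ℤ.* + K ℤ.* + T         ≡⟨ trans (ℤ.pos-* (2 * K) T) (cong (ℤ._* + T) (ℤ.pos-* 2 K)) ⟨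
    + (2 * K * T)               ≤⟨ +≤+ 2KT≤ss′+X ⟩
    + (s * s′ + X)              ≡⟨ trans (ℤ.pos-+ (s * s′) X) (cong (ℤ._+ + X) (ℤ.pos-* s s′)) ⟩
    + s ℤ.* + s′ ℤ.+ + X        ∎
  expand : ∀ s′ k C → let s = + 1 ℤ.+ s′; j = + 2 ℤ.+ k; K = + 1 ℤ.+ k in
           s ℤ.* ((+ 2 ℤ.* C) ℤ.* (j ℤ.* K) ℤ.+ ℤ.- s′ ℤ.* j)
           ≡ j ℤ.* (+ 2 ℤ.* K ℤ.* (s ℤ.* C)) ℤ.- j ℤ.* (s ℤ.* s′)
  expand = solve 3 (λ s′ k C → let s = con (+ 1) :+ s′; j = con (+ 2) :+ k; K = con (+ 1) :+ k in
                     s :* ((con (+ 2) :* C) :* (j :* K) :+ :- s′ :* j)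
                     := j :* (con (+ 2) :* K :* (s :* C)) :- j :* (s :* s′)) refl
    where open ℤSolver
  cancel : ∀ j a x → j ℤ.* (a ℤ.+ x) ℤ.- j ℤ.* a ≡ j ℤ.* x
  cancel = solve 3 (λ j a x → j :* (a :+ x) :- j :* a := j :* x) refl
    where open ℤSolver
  reorder : ∀ n t j K → j * (n * (t * (j * K))) ≡ n * (t * (j * 1 * (j * K)))
  reorder = solve 4 (λ n t j K → j :* (n :* (t :* (j :* K))) := n :* (t :* (j :* con 1 :* (j :* K)))) refl
    where open +-*-Solver

pairing-bound : ∀ {s′ t′ n T} (C : ℤ) k → + suc s′ ℤ.* C ℤ.≤ + T →
                2 * (1 + k) * T + suc s′ ≤ suc s′ * suc s′ + n * (suc t′ * ((2 + k) * (1 + k))) →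
                (+ suc s′ / suc t′) ℚ.* ((+ 2 / (2 + k)) ℚ.* (C / 1) ℚ.- + s′ / ((2 + k) * (1 + k))) ℚ.≤ + n / 1
pairing-bound {s′} {t′} {n} C k sC≤T pairs =
  ≤-/1-cross _ (+ n) (toℚᵘ-scale (suc s′) (suc t′) (toℚᵘ-termJ s′ k C)) (termJᵘ-cross {t′ = t′} {n} C k sC≤T pairs)

proposition2p4 : (t s c σ γ : ℕ) → .{{_ : NonZero t}} → .{{_ : NonZero s}} → .{{_ : NonZero c}} → .{{_ : NonZero σ}} → .{{_ : NonZero γ}} →
    (S : Schedule t s c σ γ) → Feasible S → lowerBound t s c σ γ ℤ.≤ + (n S)
proposition2p4 (suc t′) (suc s′) c (suc σ′) (suc γ′) S F =
  ceiling-≤ _ (+ n S)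
    (foldr-⊔-preserves (λ q → (+ suc s′ / suc t′) ℚ.* q ℚ.≤ + n S / 1) (termJ (suc s′) c (suc γ′))
      (capacity-bound {s = suc s′} {n = n S} C sC≤seatings seatings≤capacity)
      (λ k → pairing-bound {n = n S} C k sC≤seatings (seatings-pair-bound F (1 + k)))
      (upTo σ′))
  where
  open Counting S
  C : ℤ
  C = ceiling (+ c / suc γ′)
  sC≤seatings : + suc s′ ℤ.* C ℤ.≤ + seatings
  sC≤seatings = subst (λ T → + suc s′ ℤ.* C ℤ.≤ + T) ∑attendance≡seatings
    (m*i≤∑ C attendance λ a → ceiling-/-≤ c (suc γ′) (attendance a) (c≤γ*attendance a (Feasible.exists F a)))
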